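{- Let $n>k\ge 3$ be integers. Then the number of subgraphs of $K_1\vee P_{n-1}$ isomorphic to $P_{k+1}$ equals $$4(k-2)\binom{n+1-k}{2}+3(n-k)-1.$$
   Context: $P_m$ is the path on $m$ vertices (so $P_{k+1}$ has $k$ edges). $K_1\vee P_{n-1}$ is the graph obtained from a path on $n-1$ vertices by adding one new vertex adjacent to all of them. -}

module Defs where

open import Data.Nat using (ℕ; zero; suc; _+_; _*_; _∸_; _≤_; _<_)
open import Data.Nat.Combinatorics using (_C_)
open import Data.Fin using (Fin; toℕ)
open import Data.Fin.Subset using (Subset; _∈_)
open import Data.Vec using (Vec; lookup)
open import Data.Bool using (Bool; true; false)
open import Data.Product using (Σ; ∃; _×_)
open import Data.Sum using (_⊎_)
open import Data.Irrelevant using (Irrelevant)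
open import Relation.Binary.PropositionalEquality using (_≡_; _≢_)
open import Function.Bundles using (_⇔_)
open import Function.Definitions using (Injective)

PathAdj : ℕ → ℕ → Set
PathAdj a b = (a ≡ suc b) ⊎ (b ≡ suc a)

-- The graph K₁ ∨ P_{n-1} on vertex set Fin n:
-- vertex 0 is the apex (adjacent to all others),
-- vertices 1, …, n-1 form the path 1 - 2 - … - (n-1).
JoinAdj : ℕ → ℕ → Set
JoinAdj a b = (a ≡ 0 × b ≢ 0) ⊎ (b ≡ 0 × a ≢ 0) ⊎ (a ≢ 0 × b ≢ 0 × PathAdj a b)

GAdj : {n : ℕ} → Fin n → Fin n → Set
GAdj i j = JoinAdj (toℕ i) (toℕ j)

EdgeSet : ℕ → Set
EdgeSet n = Vec (Vec Bool n) n

edge : {n : ℕ} → EdgeSet n → Fin n → Fin n → Bool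
edge E i j = lookup (lookup E i) j

IsSubgraph : {n : ℕ} → Subset n → EdgeSet n → Set
IsSubgraph {n} V E =
  ((i j : Fin n) → edge E i j ≡ edge E j i) ×
  ((i : Fin n) → edge E i i ≡ false) ×
  ((i j : Fin n) → edge E i j ≡ true → (i ∈ V) × (j ∈ V) × GAdj i j)

IsoToPath : {n : ℕ} → (m : ℕ) → Subset n → EdgeSet n → Set
IsoToPath {n} m V E =
  Σ (Fin m → Fin n) λ f →
    Injective _≡_ _≡_ f ×
    ((v : Fin n) → v ∈ V ⇔ ∃ λ i → f i ≡ v) ×
    ((i j : Fin m) → edge E (f i) (f j) ≡ true ⇔ PathAdj (toℕ i) (toℕ j))

-- The type of subgraphs of K₁ ∨ P_{n-1} isomorphic to P_m.  A subgraph is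
-- the pair (V , E); the property is proof-irrelevant, so elements of this
-- type correspond exactly to such subgraphs.
SubgraphsIsoPath : ℕ → ℕ → Set
SubgraphsIsoPath n m =
  Σ (Subset n) λ V → Σ (EdgeSet n) λ E →
    Irrelevant (IsSubgraph V E × IsoToPath m V E)

pathCount : ℕ → ℕ → ℕ
pathCount n k = 4 * (k ∸ 2) * ((n + 1 ∸ k) C 2) + 3 * (n ∸ k) ∸ 1

-- A path subgraph of K₁ ∨ P_{n-1} is encoded by the sequence of its vertices, which it
-- determines up to reversal. Write n = k + 1 + d. A path with k edges either avoids the apex
-- 0, and is then one of the d runs of k + 1 consecutive rim vertices; or it starts at the
-- apex and continues along a run of k rim vertices (d + 1 positions, two directions); or the
-- apex splits it into two disjoint runs of s and k − s rim vertices, 1 ≤ s < k. Read so that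
-- the run of smaller vertices comes first, such a path is fixed by the offset x of that run
-- and the gap g between the runs, x + g ≤ d (C(d + 2, 2) choices), together with s and the
-- directions of the runs, the direction of a one-vertex run being immaterial: 2 choices for
-- s = 1 and for s = k − 1 and 4 for each of the k − 3 other values of s. In total
-- d + 2(d + 1) + 4(k − 2) C(d + 2, 2) = 4(k − 2) C(n + 1 − k, 2) + 3(n − k) − 1.

module Submission where

open import Defs
open import Data.Bool using (Bool; true; false; not)
import Data.Bool.Properties as Bool
open import Data.Empty
open import Data.Fin using (Fin; toℕ; fromℕ<)
import Data.Fin as Fin
open import Data.Fin.Properties
  using (toℕ-injective; toℕ<n; toℕ-fromℕ<; +↔⊎; *↔×; 2↔Bool; any?)
  renaming (suc-injective to Fin-suc-injective)
open import Data.Fin.Subset using (Subset) renaming (_∈_ to _∈ₛ_)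
open import Data.Irrelevant using (Irrelevant)
open import Data.List using (List; []; _∷_; _++_; reverse; length; [_]; _∷ʳ_; tabulate; lookup)
open import Data.List.Properties
  using ( reverse-++; unfold-reverse; reverse-involutive; ∷-injective; ∷-injectiveˡ; ∷-injectiveʳ
        ; length-++; length-reverse; ++-assoc; tabulate-lookup; length-tabulate)
open import Data.List.Membership.Propositional using (_∈_; _∉_)
open import Data.List.Membership.Propositional.Properties using (∈-∃++; ∈-tabulate⁺; ∈-tabulate⁻)
open import Data.List.Relation.Unary.Any using (here; there)
import Data.List.Relation.Unary.Any.Properties as Any
open import Data.Nat
open import Data.Nat.Combinatorics using (_C_; nCk+nC[k+1]≡[n+1]C[k+1]; nC1≡n)
open import Data.Nat.Properties
open import Data.Nat.Tactic.RingSolver using (solve-∀)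
open import Data.List.Membership.DecPropositional _≟_ using (_∈?_)
open import Data.Product using (Σ; ∃; _×_; _,_; proj₁; proj₂; map₁; map₂)
open import Data.Product.Function.NonDependent.Propositional using (_×-↔_)
import Data.Product.Properties as Product
open import Data.Sum using (_⊎_; inj₁; inj₂; [_,_]′; swap) renaming (map to ⊎-map)
open import Data.Sum.Function.Propositional using (_⊎-↔_)
open import Data.Unit using (⊤; tt)
import Data.Vec as Vec
import Data.Vec.Properties as Vec
open import Data.Vec.Properties
  using (lookup∘tabulate; tabulate∘lookup; tabulate-cong; []=⇒lookup; lookup⇒[]=)
open import Function using (_∘′_; case_of_)
open import Function.Bundles using (_↔_; mk↔ₛ′; _⇔_; mk⇔; Equivalence; Inverse)
open import Function.Definitions using (Injective)
open import Function.Properties.Inverse using (↔-trans; ↔-refl)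
open import Function.Related.TypeIsomorphisms using (Σ-assoc)
open import Relation.Binary.Definitions using (DecidableEquality; Symmetric)
open import Relation.Binary.PropositionalEquality hiding ([_])
open import Relation.Nullary using (¬_; Dec; yes; no; does)
open import Relation.Nullary.Decidable using (_⊎-dec_; dec-true; dec-false; does-⇔; recompute)

data Distinct : List ℕ → Set where
  [] : Distinct []
  _∷_ : ∀ {x xs} → x ∉ xs → Distinct xs → Distinct (x ∷ xs)

Disjoint : List ℕ → List ℕ → Set
Disjoint P Q = ∀ {v} → v ∈ P → v ∉ Q

data Consecutive (x y : ℕ) : List ℕ → Set where
  hd : ∀ {r} → Consecutive x y (x ∷ y ∷ r)
  tl : ∀ {z r} → Consecutive x y r → Consecutive x y (z ∷ r)

Edge : ℕ → ℕ → List ℕ → Set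
Edge x y L = Consecutive x y L ⊎ Consecutive y x L

Chain : (ℕ → ℕ → Set) → List ℕ → Set
Chain R L = ∀ {x y} → Consecutive x y L → R x y

consecutive-∈ˡ : ∀ {x y L} → Consecutive x y L → x ∈ L
consecutive-∈ˡ hd = here refl
consecutive-∈ˡ (tl p) = there (consecutive-∈ˡ p)

consecutive-∈ʳ : ∀ {x y L} → Consecutive x y L → y ∈ L
consecutive-∈ʳ hd = there (here refl)
consecutive-∈ʳ (tl p) = there (consecutive-∈ʳ p)

edge-∈ˡ : ∀ {x y L} → Edge x y L → x ∈ L
edge-∈ˡ = [ consecutive-∈ˡ , consecutive-∈ʳ ]′

edge-∈ʳ : ∀ {x y L} → Edge x y L → y ∈ L
edge-∈ʳ = [ consecutive-∈ʳ , consecutive-∈ˡ ]′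

edge-sym : ∀ {x y L} → Edge x y L → Edge y x L
edge-sym = swap

consecutive-irrefl : ∀ {x L} → Distinct L → ¬ Consecutive x x L
consecutive-irrefl (x∉ ∷ _) hd = x∉ (here refl)
consecutive-irrefl (_ ∷ d) (tl p) = consecutive-irrefl d p

consecutive-++⁺ˡ : ∀ {x y} P Q → Consecutive x y P → Consecutive x y (P ++ Q)
consecutive-++⁺ˡ (_ ∷ _ ∷ _) Q hd = hd
consecutive-++⁺ˡ (_ ∷ P) Q (tl p) = tl (consecutive-++⁺ˡ P Q p)

consecutive-++⁺ʳ : ∀ {x y} P Q → Consecutive x y Q → Consecutive x y (P ++ Q)
consecutive-++⁺ʳ [] Q p = p
consecutive-++⁺ʳ (_ ∷ P) Q p = tl (consecutive-++⁺ʳ P Q p)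

consecutive-++⁻ : ∀ {x y} P Q → Consecutive x y (P ++ Q) →
  Consecutive x y P ⊎ Consecutive x y Q ⊎ (x ∈ P × ∃ λ Q′ → Q ≡ y ∷ Q′)
consecutive-++⁻ [] Q p = inj₂ (inj₁ p)
consecutive-++⁻ (a ∷ []) (b ∷ Q) hd = inj₂ (inj₂ (here refl , Q , refl))
consecutive-++⁻ (a ∷ []) Q (tl p) = inj₂ (inj₁ p)
consecutive-++⁻ (a ∷ b ∷ P) Q hd = inj₁ hd
consecutive-++⁻ (a ∷ b ∷ P) Q (tl p) with consecutive-++⁻ (b ∷ P) Q p
... | inj₁ q = inj₁ (tl q)
... | inj₂ (inj₁ q) = inj₂ (inj₁ q)
... | inj₂ (inj₂ (x∈P , Q≡y∷Q′)) = inj₂ (inj₂ (there x∈P , Q≡y∷Q′))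

consecutive-reverse⁺ : ∀ {x y L} → Consecutive x y L → Consecutive y x (reverse L)
consecutive-reverse⁺ {x} {y} (hd {r}) =
  subst (Consecutive y x) (sym (reverse-++ (x ∷ y ∷ []) r))
    (consecutive-++⁺ʳ (reverse r) (y ∷ x ∷ []) hd)
consecutive-reverse⁺ {x} {y} (tl {z} {r} p) =
  subst (Consecutive y x) (sym (unfold-reverse z r))
    (consecutive-++⁺ˡ (reverse r) [ z ] (consecutive-reverse⁺ p))

consecutive-reverse⁻ : ∀ {x y L} → Consecutive x y (reverse L) → Consecutive y x L
consecutive-reverse⁻ {L = L} p =
  subst (Consecutive _ _) (reverse-involutive L) (consecutive-reverse⁺ p)

edge-reverse⁺ : ∀ {x y L} → Edge x y L → Edge x y (reverse L)
edge-reverse⁺ = swap ∘′ ⊎-map consecutive-reverse⁺ consecutive-reverse⁺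

edge-reverse⁻ : ∀ {x y L} → Edge x y (reverse L) → Edge x y L
edge-reverse⁻ = swap ∘′ ⊎-map consecutive-reverse⁻ consecutive-reverse⁻

distinct-++⁺ : ∀ P Q → Distinct P → Distinct Q → Disjoint P Q → Distinct (P ++ Q)
distinct-++⁺ [] Q _ dQ _ = dQ
distinct-++⁺ (x ∷ P) Q (x∉P ∷ dP) dQ disjoint =
  [ x∉P , disjoint (here refl) ]′ ∘′ Any.++⁻ P ∷ distinct-++⁺ P Q dP dQ (disjoint ∘′ there)

distinct-++⁻ : ∀ P Q → Distinct (P ++ Q) → Distinct P × Distinct Q × Disjoint P Q
distinct-++⁻ [] Q d = [] , d , λ ()
distinct-++⁻ (x ∷ P) Q (x∉ ∷ d) with distinct-++⁻ P Q d
... | dP , dQ , disjoint = (x∉ ∘′ Any.++⁺ˡ) ∷ dP , dQ , disjoint′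
  where
  disjoint′ : Disjoint (x ∷ P) Q
  disjoint′ (here refl) = x∉ ∘′ Any.++⁺ʳ P
  disjoint′ (there v∈P) = disjoint v∈P

distinct-reverse : ∀ {L} → Distinct L → Distinct (reverse L)
distinct-reverse {[]} [] = []
distinct-reverse {x ∷ L} (x∉L ∷ dL) =
  subst Distinct (sym (unfold-reverse x L))
    (distinct-++⁺ (reverse L) [ x ] (distinct-reverse dL) ((λ ()) ∷ [])
      (λ { v∈rL (here refl) → x∉L (Any.reverse⁻ v∈rL) }))

chain-reverse : ∀ {R} → Symmetric R → ∀ {L} → Chain R L → Chain R (reverse L)
chain-reverse R-sym c p = R-sym (c (consecutive-reverse⁻ p))

chain-++ˡ : ∀ {R} P Q → Chain R (P ++ Q) → Chain R P
chain-++ˡ P Q c p = c (consecutive-++⁺ˡ P Q p)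

chain-++ʳ : ∀ {R} P Q → Chain R (P ++ Q) → Chain R Q
chain-++ʳ P Q c p = c (consecutive-++⁺ʳ P Q p)

chain-tail : ∀ {R x L} → Chain R (x ∷ L) → Chain R L
chain-tail c p = c (tl p)

consecutive? : ∀ x y L → Dec (Consecutive x y L)
consecutive? x y [] = no λ ()
consecutive? x y (a ∷ []) = no λ { (tl ()) }
consecutive? x y (a ∷ b ∷ r) with x ≟ a | y ≟ b | consecutive? x y (b ∷ r)
... | yes refl | yes refl | _ = yes hd
... | _ | _ | yes p = yes (tl p)
... | no x≢a | _ | no ¬p = no λ { hd → x≢a refl ; (tl p) → ¬p p }
... | yes _ | no y≢b | no ¬p = no λ { hd → y≢b refl ; (tl p) → ¬p p }

edge? : ∀ x y L → Dec (Edge x y L)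
edge? x y L = consecutive? x y L ⊎-dec consecutive? y x L

_⊆ₑ_ : List ℕ → List ℕ → Set
L ⊆ₑ L′ = ∀ {x y} → Edge x y L → Edge x y L′

head-neighbour-unique : ∀ {c z r y} → Distinct (c ∷ z ∷ r) → Edge c y (c ∷ z ∷ r) → y ≡ z
head-neighbour-unique d (inj₁ hd) = refl
head-neighbour-unique (c∉ ∷ _) (inj₁ (tl p)) = ⊥-elim (c∉ (consecutive-∈ˡ p))
head-neighbour-unique (c∉ ∷ _) (inj₂ hd) = ⊥-elim (c∉ (here refl))
head-neighbour-unique (c∉ ∷ _) (inj₂ (tl p)) = ⊥-elim (c∉ (consecutive-∈ʳ p))

edge-∷⁻ : ∀ {a x y L} → Edge x y (a ∷ L) → Edge x y L ⊎ a ≡ x ⊎ a ≡ y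
edge-∷⁻ (inj₁ hd) = inj₂ (inj₁ refl)
edge-∷⁻ (inj₁ (tl p)) = inj₁ (inj₁ p)
edge-∷⁻ (inj₂ hd) = inj₂ (inj₂ refl)
edge-∷⁻ (inj₂ (tl p)) = inj₁ (inj₂ p)

edge-∷⁺ : ∀ {a x y L} → Edge x y L → Edge x y (a ∷ L)
edge-∷⁺ = ⊎-map tl tl

no-edge-[_] : ∀ {x y} a → ¬ Edge x y [ a ]
no-edge-[ a ] (inj₁ (tl ()))
no-edge-[ a ] (inj₂ (tl ()))

same-edges-same-head⇒≡ : ∀ a r r′ → Distinct (a ∷ r) → Distinct (a ∷ r′) →
  (a ∷ r) ⊆ₑ (a ∷ r′) → (a ∷ r′) ⊆ₑ (a ∷ r) → r ≡ r′
same-edges-same-head⇒≡ a [] [] _ _ _ _ = refl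
same-edges-same-head⇒≡ a [] (b ∷ r′) _ _ _ ⊇ = ⊥-elim (no-edge-[ a ] (⊇ (inj₁ hd)))
same-edges-same-head⇒≡ a (b ∷ r) [] _ _ ⊆ _ = ⊥-elim (no-edge-[ a ] (⊆ (inj₁ hd)))
same-edges-same-head⇒≡ a (b ∷ r) (b′ ∷ r′) d@(a∉r ∷ dr) d′@(a∉r′ ∷ dr′) ⊆ ⊇
  with head-neighbour-unique d (⊇ (inj₁ hd))
... | refl = cong (b ∷_) (same-edges-same-head⇒≡ b r r′ dr dr′
                            (drop-head a∉r ⊆) (drop-head a∉r′ ⊇))
  where
  drop-head : ∀ {L L′} → a ∉ L → (a ∷ L) ⊆ₑ (a ∷ L′) → L ⊆ₑ L′
  drop-head a∉L ⊆′ e with edge-∷⁻ (⊆′ (edge-∷⁺ e))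
  ... | inj₁ e′ = e′
  ... | inj₂ (inj₁ refl) = ⊥-elim (a∉L (edge-∈ˡ e))
  ... | inj₂ (inj₂ refl) = ⊥-elim (a∉L (edge-∈ʳ e))

consecutive-last : ∀ x P c Q → ∃ λ p → p ∈ x ∷ P × Consecutive p c ((x ∷ P) ++ c ∷ Q)
consecutive-last x [] c Q = x , here refl , hd
consecutive-last x (y ∷ P) c Q with consecutive-last y P c Q
... | p , p∈P , p→c = p , there p∈P , tl p→c

-- Locate the head c of L′ in L: at the head of L, at its end, or in the interior,
-- where it would have two distinct neighbours although it has only one in L′.
same-edges⇒≡⊎reverse : ∀ L L′ → 2 ≤ length L′ → Distinct L → Distinct L′ →
  L ⊆ₑ L′ → L′ ⊆ₑ L → L′ ≡ L ⊎ L′ ≡ reverse L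
same-edges⇒≡⊎reverse L (_ ∷ []) (s≤s ())
same-edges⇒≡⊎reverse L (c ∷ z ∷ r) _ d d′ ⊆ ⊇ with ∈-∃++ (edge-∈ˡ (⊇ (inj₁ hd)))
... | [] , Q , refl = inj₁ (cong (c ∷_) (sym (same-edges-same-head⇒≡ c Q (z ∷ r) d d′ ⊆ ⊇)))
... | x ∷ P , [] , refl =
  inj₂ (trans (cong (c ∷_) (same-edges-same-head⇒≡ c (z ∷ r) (reverse (x ∷ P)) d′
                             (subst Distinct rev≡ (distinct-reverse d))
                             (λ e → subst (Edge _ _) rev≡ (edge-reverse⁺ (⊇ e)))
                             (λ e → ⊆ (edge-reverse⁻ (subst (Edge _ _) (sym rev≡) e)))))
              (sym rev≡))
  where
  rev≡ : reverse ((x ∷ P) ++ [ c ]) ≡ c ∷ reverse (x ∷ P)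
  rev≡ = reverse-++ (x ∷ P) [ c ]
... | x ∷ P , q ∷ Q , refl with consecutive-last x P c (q ∷ Q)
... | p , p∈P , p→c =
  ⊥-elim (disjoint p∈P (subst (_∈ c ∷ q ∷ Q) (trans q≡z (sym p≡z)) (there (here refl))))
  where
  q≡z : q ≡ z
  q≡z = head-neighbour-unique d′ (⊆ (inj₁ (consecutive-++⁺ʳ (x ∷ P) _ hd)))
  p≡z : p ≡ z
  p≡z = head-neighbour-unique d′ (⊆ (inj₂ p→c))
  disjoint : Disjoint (x ∷ P) (c ∷ q ∷ Q)
  disjoint = proj₂ (proj₂ (distinct-++⁻ (x ∷ P) (c ∷ q ∷ Q) d))

distinct-tabulate : ∀ {m} (g : Fin m → ℕ) → Injective _≡_ _≡_ g → Distinct (tabulate g)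
distinct-tabulate {zero} g _ = []
distinct-tabulate {suc m} g g-inj = g₀∉ ∷ distinct-tabulate (g ∘′ Fin.suc) (Fin-suc-injective ∘′ g-inj)
  where
  g₀∉ : g Fin.zero ∉ tabulate (g ∘′ Fin.suc)
  g₀∉ g₀∈ with ∈-tabulate⁻ g₀∈
  ... | i , eq with g-inj eq
  ... | ()

distinct-tabulate⁻ : ∀ {m} (g : Fin m → ℕ) → Distinct (tabulate g) → Injective _≡_ _≡_ g
distinct-tabulate⁻ g _ {Fin.zero} {Fin.zero} _ = refl
distinct-tabulate⁻ g (g₀∉ ∷ _) {Fin.zero} {Fin.suc j} eq = 
  ⊥-elim (g₀∉ (subst (_∈ tabulate (g ∘′ Fin.suc)) (sym eq) (∈-tabulate⁺ j)))
distinct-tabulate⁻ g (g₀∉ ∷ _) {Fin.suc i} {Fin.zero} eq = 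
  ⊥-elim (g₀∉ (subst (_∈ tabulate (g ∘′ Fin.suc)) eq (∈-tabulate⁺ i)))
distinct-tabulate⁻ g (_ ∷ d) {Fin.suc i} {Fin.suc j} eq =
  cong Fin.suc (distinct-tabulate⁻ (g ∘′ Fin.suc) d eq)

consecutive-tabulate⁺ : ∀ {m} (g : Fin m → ℕ) i j → toℕ j ≡ suc (toℕ i) →
  Consecutive (g i) (g j) (tabulate g)
consecutive-tabulate⁺ {suc (suc m)} g Fin.zero (Fin.suc Fin.zero) _ = hd
consecutive-tabulate⁺ {suc m} g Fin.zero (Fin.suc (Fin.suc j)) ()
consecutive-tabulate⁺ {suc m} g (Fin.suc i) (Fin.suc j) eq =
  tl (consecutive-tabulate⁺ (g ∘′ Fin.suc) i j (suc-injective eq))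

consecutive-tabulate⁻ : ∀ {m} (g : Fin m → ℕ) {x y} → Consecutive x y (tabulate g) →
  ∃ λ i → ∃ λ j → toℕ j ≡ suc (toℕ i) × g i ≡ x × g j ≡ y
consecutive-tabulate⁻ {suc zero} g (tl ())
consecutive-tabulate⁻ {suc (suc m)} g hd = Fin.zero , Fin.suc Fin.zero , refl , refl , refl
consecutive-tabulate⁻ {suc (suc m)} g (tl p) with consecutive-tabulate⁻ (g ∘′ Fin.suc) p
... | i , j , j≡1+i , gi≡x , gj≡y = Fin.suc i , Fin.suc j , cong suc j≡1+i , gi≡x , gj≡y

edge-tabulate⇔ : ∀ {m} (g : Fin m → ℕ) → Injective _≡_ _≡_ g → ∀ i j →
  Edge (g i) (g j) (tabulate g) ⇔ PathAdj (toℕ i) (toℕ j)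
edge-tabulate⇔ g g-inj i j = mk⇔ to from
  where
  indices : ∀ {i j} → Consecutive (g i) (g j) (tabulate g) → toℕ j ≡ suc (toℕ i)
  indices c with consecutive-tabulate⁻ g c
  ... | i′ , j′ , j′≡1+i′ , gi′≡gi , gj′≡gj with g-inj gi′≡gi | g-inj gj′≡gj
  ... | refl | refl = j′≡1+i′
  to : Edge (g i) (g j) (tabulate g) → PathAdj (toℕ i) (toℕ j)
  to = swap ∘′ ⊎-map indices indices
  from : PathAdj (toℕ i) (toℕ j) → Edge (g i) (g j) (tabulate g)
  from = swap ∘′ ⊎-map (consecutive-tabulate⁺ g j i) (consecutive-tabulate⁺ g i j)

up : ℕ → ℕ → List ℕ
up a zero = []
up a (suc s) = a ∷ up (suc a) s

down : ℕ → ℕ → List ℕ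
down a zero = []
down a (suc s) = s + a ∷ down a s

run : ℕ → ℕ → Bool → List ℕ
run a s true = up a s
run a s false = down a s

length-up : ∀ a s → length (up a s) ≡ s
length-up a zero = refl
length-up a (suc s) = cong suc (length-up (suc a) s)

length-down : ∀ a s → length (down a s) ≡ s
length-down a zero = refl
length-down a (suc s) = cong suc (length-down a s)

length-run : ∀ a s d → length (run a s d) ≡ s
length-run a s true = length-up a s
length-run a s false = length-down a s

∈-up⁻ : ∀ {v} a s → v ∈ up a s → a ≤ v × v < s + a
∈-up⁻ a (suc s) (here refl) = ≤-refl , s≤s (m≤n+m a s)
∈-up⁻ {v} a (suc s) (there v∈) with ∈-up⁻ (suc a) s v∈
... | a<v , v<s+1+a = <⇒≤ a<v , subst (v <_) (+-suc s a) v<s+1+a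

∈-up⁺ : ∀ {v} a s → a ≤ v → v < s + a → v ∈ up a s
∈-up⁺ a zero a≤v v<a = ⊥-elim (<⇒≱ v<a a≤v)
∈-up⁺ {v} a (suc s) a≤v v< with m≤n⇒m<n∨m≡n a≤v
... | inj₂ refl = here refl
... | inj₁ a<v = there (∈-up⁺ (suc a) s a<v (subst (v <_) (sym (+-suc s a)) v<))

∈-down⁻ : ∀ {v} a s → v ∈ down a s → a ≤ v × v < s + a
∈-down⁻ a (suc s) (here refl) = m≤n+m a s , ≤-refl
∈-down⁻ a (suc s) (there v∈) = map₂ m≤n⇒m≤1+n (∈-down⁻ a s v∈)

∈-down⁺ : ∀ {v} a s → a ≤ v → v < s + a → v ∈ down a s
∈-down⁺ a zero a≤v v<a = ⊥-elim (<⇒≱ v<a a≤v)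
∈-down⁺ a (suc s) a≤v v< with m≤n⇒m<n∨m≡n (s≤s⁻¹ v<)
... | inj₂ refl = here refl
... | inj₁ v<s+a = there (∈-down⁺ a s a≤v v<s+a)

∈-run⁻ : ∀ {v} a s d → v ∈ run a s d → a ≤ v × v < s + a
∈-run⁻ a s true = ∈-up⁻ a s
∈-run⁻ a s false = ∈-down⁻ a s

∈-run⁺ : ∀ {v} a s d → a ≤ v → v < s + a → v ∈ run a s d
∈-run⁺ a s true = ∈-up⁺ a s
∈-run⁺ a s false = ∈-down⁺ a s

start∈run : ∀ a s d → 1 ≤ s → a ∈ run a s d
start∈run a s d 1≤s = ∈-run⁺ a s d ≤-refl (m<n+m a 1≤s)

last∈run : ∀ a s d → s + a ∈ run a (suc s) d
last∈run a s d = ∈-run⁺ a (suc s) d (m≤n+m a s) ≤-refl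

0∉run : ∀ a s d → 0 ∉ run (suc a) s d
0∉run a s d 0∈ with ∈-run⁻ (suc a) s d 0∈
... | () , _

up-∷ʳ : ∀ a s → up a (suc s) ≡ up a s ∷ʳ (s + a)
up-∷ʳ a zero = refl
up-∷ʳ a (suc s) = cong (a ∷_) (trans (up-∷ʳ (suc a) s) (cong (up (suc a) s ∷ʳ_) (+-suc s a)))

reverse-up : ∀ a s → reverse (up a s) ≡ down a s
reverse-up a zero = refl
reverse-up a (suc s) = begin
  reverse (up a (suc s))        ≡⟨ cong reverse (up-∷ʳ a s) ⟩
  reverse (up a s ++ [ s + a ]) ≡⟨ reverse-++ (up a s) [ s + a ] ⟩
  s + a ∷ reverse (up a s)      ≡⟨ cong (s + a ∷_) (reverse-up a s) ⟩
  down a (suc s)                ∎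
  where open ≡-Reasoning

reverse-run : ∀ a s d → reverse (run a s d) ≡ run a s (not d)
reverse-run a s true = reverse-up a s
reverse-run a s false = begin
  reverse (down a s)           ≡⟨ cong reverse (reverse-up a s) ⟨
  reverse (reverse (up a s))   ≡⟨ reverse-involutive (up a s) ⟩
  up a s                       ∎
  where open ≡-Reasoning

chain-up : ∀ a s → Chain PathAdj (up a s)
chain-up a (suc (suc s)) hd = inj₂ refl
chain-up a (suc s) (tl p) = chain-up (suc a) s p

chain-down : ∀ a s → Chain PathAdj (down a s)
chain-down a (suc (suc s)) hd = inj₁ refl
chain-down a (suc s) (tl p) = chain-down a s p

chain-run : ∀ a s d → Chain PathAdj (run a s d)
chain-run a s true = chain-up a s
chain-run a s false = chain-down a s

distinct-up : ∀ a s → Distinct (up a s)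
distinct-up a zero = []
distinct-up a (suc s) = (λ a∈ → <-irrefl refl (proj₁ (∈-up⁻ (suc a) s a∈))) ∷ distinct-up (suc a) s

distinct-down : ∀ a s → Distinct (down a s)
distinct-down a zero = []
distinct-down a (suc s) = (λ s+a∈ → <-irrefl refl (proj₂ (∈-down⁻ a s s+a∈))) ∷ distinct-down a s

distinct-run : ∀ a s d → Distinct (run a s d)
distinct-run a s true = distinct-up a s
distinct-run a s false = distinct-down a s

run-cong-direction : ∀ a s {d d′} → (2 ≤ s → d ≡ d′) → run a s d ≡ run a s d′
run-cong-direction a s {true} {true} _ = refl
run-cong-direction a s {false} {false} _ = refl
run-cong-direction a zero {true} {false} _ = refl
run-cong-direction a zero {false} {true} _ = refl
run-cong-direction a (suc zero) {true} {false} _ = refl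
run-cong-direction a (suc zero) {false} {true} _ = refl
run-cong-direction a (suc (suc s)) d≡d′ = cong (run a (suc (suc s))) (d≡d′ (s≤s (s≤s z≤n)))

run-length-injective : ∀ {a a′ s s′ d d′} → run a s d ≡ run a′ s′ d′ → s ≡ s′
run-length-injective {a} {a′} {s} {s′} {d} {d′} eq =
  trans (sym (length-run a s d)) (trans (cong length eq) (length-run a′ s′ d′))

run-start-injective : ∀ {a a′ s d d′} → run a (suc s) d ≡ run a′ (suc s) d′ → a ≡ a′
run-start-injective {a} {a′} {s} {d} {d′} eq =
  ≤-antisym (proj₁ (∈-run⁻ a (suc s) d (subst (a′ ∈_) (sym eq) (start∈run a′ (suc s) d′ (s≤s z≤n)))))
            (proj₁ (∈-run⁻ a′ (suc s) d′ (subst (a ∈_) eq (start∈run a (suc s) d (s≤s z≤n)))))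

run-direction-injective : ∀ {a s d d′} → run a (suc (suc s)) d ≡ run a (suc (suc s)) d′ → d ≡ d′
run-direction-injective {a} {s} {true} {true} eq = refl
run-direction-injective {a} {s} {false} {false} eq = refl
run-direction-injective {a} {s} {true} {false} eq =
  ⊥-elim (<-irrefl (∷-injectiveˡ eq) (s≤s (m≤n+m a s)))
run-direction-injective {a} {s} {false} {true} eq =
  ⊥-elim (<-irrefl (sym (∷-injectiveˡ eq)) (s≤s (m≤n+m a s)))

run-injective : ∀ a a′ s s′ d d′ → run a s d ≡ run a′ s′ d′ →
  s ≡ s′ × (1 ≤ s → a ≡ a′) × (2 ≤ s → d ≡ d′)
run-injective a a′ s s′ d d′ eq with run-length-injective {a} {a′} {s} {s′} {d} {d′} eq
run-injective a a′ zero _ d d′ eq | refl = refl , (λ ()) , (λ ())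
run-injective a a′ (suc zero) _ d d′ eq | refl =
  refl , (λ _ → run-start-injective {d = d} {d′ = d′} eq) , (λ { (s≤s ()) })
run-injective a a′ (suc (suc s)) _ d d′ eq | refl with run-start-injective {a} {a′} {suc s} {d} {d′} eq
... | refl = refl , (λ _ → refl) , (λ _ → run-direction-injective eq)

-- Being distinct, a chain of numbers differing by one never turns back.
pathAdj-chain⇒run : ∀ x r → Distinct (x ∷ r) → Chain PathAdj (x ∷ r) →
  ∃ λ a → ∃ λ s → ∃ λ d → x ∷ r ≡ run a (suc s) d
pathAdj-chain⇒run x [] _ _ = x , 0 , true , refl
pathAdj-chain⇒run x (y ∷ r) (x∉ ∷ dr) c with pathAdj-chain⇒run y r dr (chain-tail c) | c hd
... | a , s , true , eq | x~y with ∷-injective eq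
...   | refl , refl with x~y
...     | inj₂ refl = x , suc s , true , refl
...     | inj₁ refl with s
...       | zero = y , 1 , false , refl
...       | suc _ = ⊥-elim (x∉ (there (here refl)))
pathAdj-chain⇒run x (y ∷ r) (x∉ ∷ dr) c | a , s , false , eq | x~y with ∷-injective eq
...   | refl , refl with x~y
...     | inj₁ refl = a , suc s , false , refl
...     | inj₂ x≡1+y with s
...       | zero = x , 1 , true , cong (λ t → x ∷ t ∷ []) x≡1+y
...       | suc s′ = ⊥-elim (x∉ (there (subst (_∈ down a (suc s′)) (suc-injective x≡1+y) (here refl))))

disjoint-runs-separated : ∀ a s b t dP dQ → 1 ≤ s → 1 ≤ t →
  Disjoint (run a s dP) (run b t dQ) → s + a ≤ b ⊎ t + b ≤ a
disjoint-runs-separated a s b t dP dQ 1≤s 1≤t disjoint with s + a ≤? b | t + b ≤? a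
... | yes P-before-Q | _ = inj₁ P-before-Q
... | no _ | yes Q-before-P = inj₂ Q-before-P
... | no P≰ | no Q≰ with ≤-total a b
...   | inj₁ a≤b = ⊥-elim (disjoint (∈-run⁺ a s dP a≤b (≰⇒> P≰)) (start∈run b t dQ 1≤t))
...   | inj₂ b≤a = ⊥-elim (disjoint (start∈run a s dP 1≤s) (∈-run⁺ b t dQ b≤a (≰⇒> Q≰)))

Bounded : ℕ → List ℕ → Set
Bounded n L = ∀ {v} → v ∈ L → v < n

OnRim : List ℕ → Set
OnRim L = ∀ {v} → v ∈ L → v ≢ 0

record RimPath (n : ℕ) (L : List ℕ) : Set where
  field
    bounded : Bounded n L
    distinct : Distinct L
    onRim : OnRim L
    chain : Chain PathAdj L

record FanPath (n : ℕ) (L : List ℕ) : Set where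
  field
    bounded : Bounded n L
    distinct : Distinct L
    chain : Chain JoinAdj L

joinAdj-sym : ∀ {x y} → JoinAdj x y → JoinAdj y x
joinAdj-sym (inj₁ p) = inj₂ (inj₁ p)
joinAdj-sym (inj₂ (inj₁ p)) = inj₁ p
joinAdj-sym (inj₂ (inj₂ (x≢0 , y≢0 , x~y))) = inj₂ (inj₂ (y≢0 , x≢0 , swap x~y))

rim-chain⇒fan-chain : ∀ {L} → OnRim L → Chain PathAdj L → Chain JoinAdj L
rim-chain⇒fan-chain onRim c p = inj₂ (inj₂ (onRim (consecutive-∈ˡ p) , onRim (consecutive-∈ʳ p) , c p))

fan-chain⇒rim-chain : ∀ {L} → OnRim L → Chain JoinAdj L → Chain PathAdj L
fan-chain⇒rim-chain onRim c p with c p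
... | inj₁ (x≡0 , _) = ⊥-elim (onRim (consecutive-∈ˡ p) x≡0)
... | inj₂ (inj₁ (y≡0 , _)) = ⊥-elim (onRim (consecutive-∈ʳ p) y≡0)
... | inj₂ (inj₂ (_ , _ , x~y)) = x~y

rimPath⇒fanPath : ∀ {n L} → RimPath n L → FanPath n L
rimPath⇒fanPath P = record
  { bounded = P.bounded ; distinct = P.distinct ; chain = rim-chain⇒fan-chain P.onRim P.chain }
  where module P = RimPath P

fanPath⇒rimPath : ∀ {n L} → OnRim L → FanPath n L → RimPath n L
fanPath⇒rimPath onRim fanL = record
  { bounded = L.bounded ; distinct = L.distinct ; onRim = onRim
  ; chain = fan-chain⇒rim-chain onRim L.chain }
  where module L = FanPath fanL

rimPath-[] : ∀ {n} → RimPath n []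
rimPath-[] = record { bounded = λ () ; distinct = [] ; onRim = λ () ; chain = λ () }

rimPath-run : ∀ n a s d → s + suc a ≤ n → RimPath n (run (suc a) s d)
rimPath-run n a s d s+1+a≤n = record
  { bounded = λ v∈ → <-≤-trans (proj₂ (∈-run⁻ (suc a) s d v∈)) s+1+a≤n
  ; distinct = distinct-run (suc a) s d
  ; onRim = λ { v∈ refl → 0∉run a s d v∈ }
  ; chain = chain-run (suc a) s d
  }

rimPath-reverse : ∀ {n L} → RimPath n L → RimPath n (reverse L)
rimPath-reverse {L = L} rimL = record
  { bounded = L.bounded ∘′ Any.reverse⁻
  ; distinct = distinct-reverse L.distinct
  ; onRim = L.onRim ∘′ Any.reverse⁻
  ; chain = chain-reverse swap L.chain
  }
  where module L = RimPath rimL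

length-≡run : ∀ a s dir {L m} → L ≡ run a s dir → length L ≡ m → s ≡ m
length-≡run a s dir refl len = trans (sym (length-run a s dir)) len

rimPath⇒run : ∀ {n x r} → RimPath n (x ∷ r) →
  ∃ λ a → ∃ λ s → ∃ λ dir → x ∷ r ≡ run (suc a) (suc s) dir × s + suc a < n
rimPath⇒run {x = x} {r} rimL with pathAdj-chain⇒run x r (RimPath.distinct rimL) (RimPath.chain rimL)
... | zero , s , dir , eq =
  ⊥-elim (RimPath.onRim rimL (subst (0 ∈_) (sym eq) (start∈run 0 (suc s) dir (s≤s z≤n))) refl)
... | suc a , s , dir , eq =
  a , s , dir , eq , RimPath.bounded rimL (subst (_ ∈_) (sym eq) (last∈run (suc a) s dir))

viaApex : List ℕ × List ℕ → List ℕ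
viaApex (P , Q) = P ++ 0 ∷ Q

0∈viaApex : ∀ P Q → 0 ∈ viaApex (P , Q)
0∈viaApex P Q = Any.++⁺ʳ P (here refl)

reverse-viaApex : ∀ P Q → reverse (viaApex (P , Q)) ≡ viaApex (reverse Q , reverse P)
reverse-viaApex P Q = begin
  reverse (P ++ 0 ∷ Q)                ≡⟨ reverse-++ P (0 ∷ Q) ⟩
  reverse (0 ∷ Q) ++ reverse P        ≡⟨ cong (_++ reverse P) (unfold-reverse 0 Q) ⟩
  (reverse Q ++ [ 0 ]) ++ reverse P   ≡⟨ ++-assoc (reverse Q) [ 0 ] (reverse P) ⟩
  reverse Q ++ 0 ∷ reverse P          ∎
  where open ≡-Reasoning

viaApex-injective : ∀ P Q P′ Q′ → 0 ∉ P → 0 ∉ P′ →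
  viaApex (P , Q) ≡ viaApex (P′ , Q′) → (P , Q) ≡ (P′ , Q′)
viaApex-injective [] Q [] Q′ _ _ eq = cong ([] ,_) (∷-injectiveʳ eq)
viaApex-injective [] Q (y ∷ P′) Q′ _ 0∉P′ eq = ⊥-elim (0∉P′ (here (∷-injectiveˡ eq)))
viaApex-injective (x ∷ P) Q [] Q′ 0∉P _ eq = ⊥-elim (0∉P (here (sym (∷-injectiveˡ eq))))
viaApex-injective (x ∷ P) Q (y ∷ P′) Q′ 0∉P 0∉P′ eq with ∷-injective eq
... | refl , eq′ = cong (map₁ (x ∷_))
                        (viaApex-injective P Q P′ Q′ (0∉P ∘′ there) (0∉P′ ∘′ there) eq′)

fanPath-viaApex : ∀ {m P Q} → RimPath (suc m) P → RimPath (suc m) Q →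
  Disjoint P Q → FanPath (suc m) (viaApex (P , Q))
fanPath-viaApex {m} {P} {Q} rimP rimQ disjoint = record
  { bounded = bounded ; distinct = distinct ; chain = chain }
  where
  module P = RimPath rimP
  module Q = RimPath rimQ
  bounded : Bounded (suc m) (P ++ 0 ∷ Q)
  bounded v∈ with Any.++⁻ P v∈
  ... | inj₁ v∈P = P.bounded v∈P
  ... | inj₂ (here refl) = s≤s z≤n
  ... | inj₂ (there v∈Q) = Q.bounded v∈Q
  distinct : Distinct (P ++ 0 ∷ Q)
  distinct = distinct-++⁺ P (0 ∷ Q) P.distinct ((λ 0∈Q → Q.onRim 0∈Q refl) ∷ Q.distinct)
    λ { v∈P (here refl) → P.onRim v∈P refl ; v∈P (there v∈Q) → disjoint v∈P v∈Q }
  chain : Chain JoinAdj (P ++ 0 ∷ Q)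
  chain p with consecutive-++⁻ P (0 ∷ Q) p
  ... | inj₁ p′ = rim-chain⇒fan-chain P.onRim P.chain p′
  ... | inj₂ (inj₁ hd) = inj₁ (refl , Q.onRim (here refl))
  ... | inj₂ (inj₁ (tl p′)) = rim-chain⇒fan-chain Q.onRim Q.chain p′
  ... | inj₂ (inj₂ (x∈P , _ , refl)) = inj₂ (inj₁ (refl , P.onRim x∈P))

fanPath-viaApex⁻ : ∀ {n} P Q → FanPath n (viaApex (P , Q)) → RimPath n P × RimPath n Q × Disjoint P Q
fanPath-viaApex⁻ P Q fanL with distinct-++⁻ P (0 ∷ Q) (FanPath.distinct fanL)
... | distinctP , 0∉Q ∷ distinctQ , disjoint = rimP , rimQ , λ v∈P v∈Q → disjoint v∈P (there v∈Q)
  where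
  module L = FanPath fanL
  onRimP : OnRim P
  onRimP v∈P refl = disjoint v∈P (here refl)
  onRimQ : OnRim Q
  onRimQ v∈Q refl = 0∉Q v∈Q
  rimP : RimPath _ P
  rimP = record { bounded = L.bounded ∘′ Any.++⁺ˡ ; distinct = distinctP ; onRim = onRimP
                ; chain = fan-chain⇒rim-chain onRimP (chain-++ˡ P (0 ∷ Q) L.chain) }
  rimQ : RimPath _ Q
  rimQ = record { bounded = L.bounded ∘′ Any.++⁺ʳ P ∘′ there ; distinct = distinctQ ; onRim = onRimQ
                ; chain = fan-chain⇒rim-chain onRimQ (chain-tail (chain-++ʳ P (0 ∷ Q) L.chain)) }

dec-true⁻¹ : ∀ {A : Set} (a? : Dec A) → does a? ≡ true → A
dec-true⁻¹ (yes a) _ = a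
dec-true⁻¹ (no _) ()

dec-≡ : ∀ {A : Set} (a? : Dec A) (b : Bool) → (A → b ≡ true) → (b ≡ true → A) → does a? ≡ b
dec-≡ (yes a) b ⇒b _ = sym (⇒b a)
dec-≡ (no _) false _ _ = refl
dec-≡ (no ¬a) true _ b⇒ = ⊥-elim (¬a (b⇒ refl))

vertexSet : ∀ n → List ℕ → Subset n
vertexSet n L = Vec.tabulate (λ v → does (toℕ v ∈? L))

edgeSet : ∀ n → List ℕ → EdgeSet n
edgeSet n L = Vec.tabulate (λ i → Vec.tabulate (λ j → does (edge? (toℕ i) (toℕ j) L)))

lookup-vertexSet : ∀ {n} L (v : Fin n) → Vec.lookup (vertexSet n L) v ≡ does (toℕ v ∈? L)
lookup-vertexSet L v = lookup∘tabulate _ v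

edge-edgeSet : ∀ {n} L (i j : Fin n) → edge (edgeSet n L) i j ≡ does (edge? (toℕ i) (toℕ j) L)
edge-edgeSet L i j = trans (cong (λ row → Vec.lookup row j) (lookup∘tabulate _ i)) (lookup∘tabulate _ j)

∈-vertexSet⁺ : ∀ {n} L (v : Fin n) → toℕ v ∈ L → v ∈ₛ vertexSet n L
∈-vertexSet⁺ {n} L v v∈L =
  lookup⇒[]= v (vertexSet n L) (trans (lookup-vertexSet L v) (dec-true (toℕ v ∈? L) v∈L))

∈-vertexSet⁻ : ∀ {n} L (v : Fin n) → v ∈ₛ vertexSet n L → toℕ v ∈ L
∈-vertexSet⁻ L v v∈V = dec-true⁻¹ (toℕ v ∈? L) (trans (sym (lookup-vertexSet L v)) ([]=⇒lookup v∈V))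

edge-edgeSet⁺ : ∀ {n} L (i j : Fin n) → Edge (toℕ i) (toℕ j) L → edge (edgeSet n L) i j ≡ true
edge-edgeSet⁺ L i j e = trans (edge-edgeSet L i j) (dec-true (edge? _ _ L) e)

edge-edgeSet⁻ : ∀ {n} L (i j : Fin n) → edge (edgeSet n L) i j ≡ true → Edge (toℕ i) (toℕ j) L
edge-edgeSet⁻ L i j e = dec-true⁻¹ (edge? _ _ L) (trans (sym (edge-edgeSet L i j)) e)

vertexSet-reverse : ∀ n L → vertexSet n (reverse L) ≡ vertexSet n L
vertexSet-reverse n L = tabulate-cong λ v →
  does-⇔ (mk⇔ Any.reverse⁻ Any.reverse⁺) (toℕ v ∈? reverse L) (toℕ v ∈? L)

edgeSet-reverse : ∀ n L → edgeSet n (reverse L) ≡ edgeSet n L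
edgeSet-reverse n L = tabulate-cong λ i → tabulate-cong λ j →
  does-⇔ (mk⇔ edge-reverse⁻ edge-reverse⁺) (edge? (toℕ i) (toℕ j) (reverse L)) (edge? _ _ L)

edgeSet⇒⊆ₑ : ∀ n L L′ → Bounded n L → edgeSet n L ≡ edgeSet n L′ → L ⊆ₑ L′
edgeSet⇒⊆ₑ n L L′ bounded eq e =
  subst₂ (λ x y → Edge x y L′) (toℕ-fromℕ< _) (toℕ-fromℕ< _)
    (edge-edgeSet⁻ L′ i j (trans (cong (λ E → edge E i j) (sym eq)) (edge-edgeSet⁺ L i j
      (subst₂ (λ x y → Edge x y L) (sym (toℕ-fromℕ< _)) (sym (toℕ-fromℕ< _)) e))))
  where
  i = fromℕ< (bounded (edge-∈ˡ e))
  j = fromℕ< (bounded (edge-∈ʳ e))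

IsPathSubgraph : ∀ {n} → ℕ → Subset n → EdgeSet n → Set
IsPathSubgraph m V E = IsSubgraph V E × IsoToPath m V E

fanPath-tabulate⇒pathSubgraph : ∀ {n m} (g : Fin m → ℕ) → FanPath n (tabulate g) →
  IsPathSubgraph m (vertexSet n (tabulate g)) (edgeSet n (tabulate g))
fanPath-tabulate⇒pathSubgraph {n} {m} g fanL =
  (symmetric , loopless , within) , f , f-injective , image , edges
  where
  module L = FanPath fanL
  L = tabulate g
  V = vertexSet n L
  E = edgeSet n L
  symmetric : ∀ i j → edge E i j ≡ edge E j i
  symmetric i j = trans (edge-edgeSet L i j)
    (trans (does-⇔ (mk⇔ edge-sym edge-sym) (edge? _ _ L) (edge? _ _ L)) (sym (edge-edgeSet L j i)))
  loopless : ∀ i → edge E i i ≡ false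
  loopless i = trans (edge-edgeSet L i i)
    (dec-false (edge? _ _ L) [ consecutive-irrefl L.distinct , consecutive-irrefl L.distinct ]′)
  within : ∀ i j → edge E i j ≡ true → (i ∈ₛ V) × (j ∈ₛ V) × GAdj i j
  within i j e = ∈-vertexSet⁺ L i (edge-∈ˡ ij) , ∈-vertexSet⁺ L j (edge-∈ʳ ij) ,
                 [ L.chain , joinAdj-sym ∘′ L.chain ]′ ij
    where ij = edge-edgeSet⁻ L i j e
  f : Fin m → Fin n
  f t = fromℕ< (L.bounded (∈-tabulate⁺ t))
  toℕ-f : ∀ t → toℕ (f t) ≡ g t
  toℕ-f t = toℕ-fromℕ< _
  f-injective : Injective _≡_ _≡_ f
  f-injective eq = distinct-tabulate⁻ g L.distinct (trans (sym (toℕ-f _)) (trans (cong toℕ eq) (toℕ-f _)))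
  image : ∀ v → v ∈ₛ V ⇔ ∃ λ t → f t ≡ v
  image v = mk⇔ to from
    where
    to : v ∈ₛ V → ∃ λ t → f t ≡ v
    to v∈V with ∈-tabulate⁻ (∈-vertexSet⁻ L v v∈V)
    ... | t , v≡gt = t , toℕ-injective (trans (toℕ-f t) (sym v≡gt))
    from : (∃ λ t → f t ≡ v) → v ∈ₛ V
    from (t , refl) = ∈-vertexSet⁺ L (f t) (subst (_∈ L) (sym (toℕ-f t)) (∈-tabulate⁺ t))
  edges : ∀ i j → edge E (f i) (f j) ≡ true ⇔ PathAdj (toℕ i) (toℕ j)
  edges i j = mk⇔
    (Equivalence.to (edge-tabulate⇔ g (distinct-tabulate⁻ g L.distinct) i j) ∘′
       subst₂ (λ x y → Edge x y L) (toℕ-f i) (toℕ-f j) ∘′ edge-edgeSet⁻ L (f i) (f j))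
    (edge-edgeSet⁺ L (f i) (f j) ∘′ subst₂ (λ x y → Edge x y L) (sym (toℕ-f i)) (sym (toℕ-f j)) ∘′
       Equivalence.from (edge-tabulate⇔ g (distinct-tabulate⁻ g L.distinct) i j))

fanPath⇒pathSubgraph : ∀ {n} L → FanPath n L → IsPathSubgraph (length L) (vertexSet n L) (edgeSet n L)
fanPath⇒pathSubgraph {n} L fanL =
  subst (λ L′ → IsPathSubgraph (length L) (vertexSet n L′) (edgeSet n L′)) (tabulate-lookup L)
    (fanPath-tabulate⇒pathSubgraph (lookup L) (subst (FanPath n) (sym (tabulate-lookup L)) fanL))

pathSubgraph⇒fanPath : ∀ {n m} V E → IsPathSubgraph m V E →
  ∃ λ L → FanPath n L × length L ≡ m × vertexSet n L ≡ V × edgeSet n L ≡ E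
pathSubgraph⇒fanPath {n} {m} V E ((_ , _ , within) , f , f-injective , image , edges) =
  L , fanL , length-tabulate g , V≡ , E≡
  where
  g : Fin m → ℕ
  g = toℕ ∘′ f
  L = tabulate g
  g-injective : Injective _≡_ _≡_ g
  g-injective = f-injective ∘′ toℕ-injective
  ∈L⇒image : ∀ {v} → toℕ v ∈ L → ∃ λ t → f t ≡ v
  ∈L⇒image v∈L with ∈-tabulate⁻ v∈L
  ... | t , v≡ = t , toℕ-injective (sym v≡)
  fanL : FanPath n L
  fanL = record
    { bounded = λ v∈L → case ∈-tabulate⁻ v∈L of λ { (t , refl) → toℕ<n (f t) }
    ; distinct = distinct-tabulate g g-injective
    ; chain = λ c → case consecutive-tabulate⁻ g c of λ { (t , t′ , t′≡1+t , refl , refl) →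
        proj₂ (proj₂ (within (f t) (f t′) (Equivalence.from (edges t t′) (inj₂ t′≡1+t)))) }
    }
  V≡ : vertexSet n L ≡ V
  V≡ = trans (tabulate-cong λ v → dec-≡ (toℕ v ∈? L) (Vec.lookup V v)
               (λ v∈L → []=⇒lookup (Equivalence.from (image v) (∈L⇒image v∈L)))
               (λ v∈V → case Equivalence.to (image v) (lookup⇒[]= v V v∈V) of λ where
                   (t , refl) → ∈-tabulate⁺ t))
             (tabulate∘lookup V)
  edge⇒ : ∀ i j → Edge (toℕ i) (toℕ j) L → edge E i j ≡ true
  edge⇒ i j e with ∈L⇒image (edge-∈ˡ e) | ∈L⇒image (edge-∈ʳ e)
  ... | t , refl | t′ , refl =
    Equivalence.from (edges t t′) (Equivalence.to (edge-tabulate⇔ g g-injective t t′) e)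
  ⇒edge : ∀ i j → edge E i j ≡ true → Edge (toℕ i) (toℕ j) L
  ⇒edge i j e with within i j e
  ... | i∈V , j∈V , _ with Equivalence.to (image i) i∈V | Equivalence.to (image j) j∈V
  ... | t , refl | t′ , refl =
    Equivalence.from (edge-tabulate⇔ g g-injective t t′) (Equivalence.to (edges t t′) e)
  E≡ : edgeSet n L ≡ E
  E≡ = trans (tabulate-cong λ i → tabulate-cong λ j →
               dec-≡ (edge? _ _ L) (edge E i j) (edge⇒ i j) (⇒edge i j))
             (trans (tabulate-cong λ i → tabulate∘lookup (Vec.lookup E i)) (tabulate∘lookup E))

-- The property is irrelevant, so a preimage cannot be read off a proof of it: it is found
-- by a search over the finite type C, whose witness is then recomputed.
finite-injection-onto⇒↔ : ∀ {N} {C A : Set} {P : A → Set} → Fin N ↔ C → DecidableEquality A →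
  (h : C → A) → Injective _≡_ _≡_ h → (∀ c → P (h c)) → (∀ a → P a → ∃ λ c → h c ≡ a) →
  C ↔ Σ A (λ a → Irrelevant (P a))
finite-injection-onto⇒↔ {C = C} {A} {P} Fin↔C _≟ᴬ_ h h-injective h-P h-onto =
  mk↔ₛ′ to from to∘from from∘to
  where
  open Inverse Fin↔C using () renaming (to to element; from to index; strictlyInverseˡ to element-index)
  onto-index : ∀ a → P a → ∃ λ i → h (element i) ≡ a
  onto-index a p with h-onto a p
  ... | c , hc≡a = index c , trans (cong h (element-index c)) hc≡a
  find : ∀ a → .(P a) → ∃ λ i → h (element i) ≡ a
  find a p = recompute (any? λ i → h (element i) ≟ᴬ a) (onto-index a p)
  to : C → Σ A (λ a → Irrelevant (P a))
  to c = h c , record { irrelevant = h-P c }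
  from : Σ A (λ a → Irrelevant (P a)) → C
  from (a , record { irrelevant = p }) = element (proj₁ (find a p))
  Σ-irrelevant-≡ : ∀ {a b} {p : Irrelevant (P a)} {q : Irrelevant (P b)} → a ≡ b → (a , p) ≡ (b , q)
  Σ-irrelevant-≡ refl = refl
  to∘from : ∀ s → to (from s) ≡ s
  to∘from (a , record { irrelevant = p }) = Σ-irrelevant-≡ (proj₂ (find a p))
  from∘to : ∀ c → from (to c) ≡ c
  from∘to c = h-injective (proj₂ (find (h c) (h-P c)))

-- Placement d enumerates the pairs (x , g) with x + g ≤ d, grouped by the value of x + g.
Placement : ℕ → Set
Placement zero = ⊤
Placement (suc d) = Placement d ⊎ Fin (suc (suc d))

placement : ∀ d → Placement d → ℕ × ℕ
placement zero tt = 0 , 0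
placement (suc d) (inj₁ p) = placement d p
placement (suc d) (inj₂ i) = toℕ i , suc d ∸ toℕ i

placement-top : ∀ d (i : Fin (suc (suc d))) → toℕ i + (suc d ∸ toℕ i) ≡ suc d
placement-top d i = m+[n∸m]≡n (s≤s⁻¹ (toℕ<n i))

placement-bound : ∀ d p → proj₁ (placement d p) + proj₂ (placement d p) ≤ d
placement-bound zero tt = z≤n
placement-bound (suc d) (inj₁ p) = m≤n⇒m≤1+n (placement-bound d p)
placement-bound (suc d) (inj₂ i) = ≤-reflexive (placement-top d i)

placement-injective : ∀ d p q → placement d p ≡ placement d q → p ≡ q
placement-injective zero tt tt _ = refl
placement-injective (suc d) (inj₁ p) (inj₁ q) eq = cong inj₁ (placement-injective d p q eq)
placement-injective (suc d) (inj₁ p) (inj₂ i) eq = ⊥-elim (1+n≰n (subst (_≤ d)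
  (trans (cong (λ (x , g) → x + g) eq) (placement-top d i)) (placement-bound d p)))
placement-injective (suc d) (inj₂ i) (inj₁ q) eq = ⊥-elim (1+n≰n (subst (_≤ d)
  (trans (cong (λ (x , g) → x + g) (sym eq)) (placement-top d i)) (placement-bound d q)))
placement-injective (suc d) (inj₂ i) (inj₂ j) eq = cong inj₂ (toℕ-injective (cong proj₁ eq))

placement-surjective : ∀ d x g → x + g ≤ d → ∃ λ p → placement d p ≡ (x , g)
placement-surjective zero zero zero _ = tt , refl
placement-surjective (suc d) x g x+g≤ with m≤n⇒m<n∨m≡n x+g≤
... | inj₁ x+g<1+d = let p , eq = placement-surjective d x g (s≤s⁻¹ x+g<1+d) in inj₁ p , eq
... | inj₂ x+g≡1+d = inj₂ (fromℕ< x<) , cong₂ _,_ (toℕ-fromℕ< x<) (begin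
  suc d ∸ toℕ (fromℕ< x<) ≡⟨ cong (suc d ∸_) (toℕ-fromℕ< x<) ⟩
  suc d ∸ x               ≡⟨ cong (_∸ x) x+g≡1+d ⟨
  x + g ∸ x               ≡⟨ m+n∸m≡n x g ⟩
  g                       ∎)
  where
  open ≡-Reasoning
  x< : x < suc (suc d)
  x< = s≤s (subst (x ≤_) x+g≡1+d (m≤m+n x g))

Fin↔Placement : ∀ d → Fin (suc (suc d) C 2) ↔ Placement d
Fin↔Placement zero =
  mk↔ₛ′ (λ _ → tt) (λ _ → Fin.zero) (λ _ → refl) (λ { Fin.zero → refl ; (Fin.suc ()) })
Fin↔Placement (suc d) =
  ↔-trans (subst (λ m → Fin (suc (suc (suc d)) C 2) ↔ Fin m) C-step ↔-refl)
          (↔-trans +↔⊎ (Fin↔Placement d ⊎-↔ ↔-refl))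
  where
  C-step : suc (suc (suc d)) C 2 ≡ suc (suc d) C 2 + suc (suc d)
  C-step = begin
    suc (suc (suc d)) C 2                    ≡⟨ nCk+nC[k+1]≡[n+1]C[k+1] (suc (suc d)) 1 ⟨
    suc (suc d) C 1 + suc (suc d) C 2        ≡⟨ cong (_+ suc (suc d) C 2) (nC1≡n (suc (suc d))) ⟩
    suc (suc d) + suc (suc d) C 2            ≡⟨ +-comm (suc (suc d)) _ ⟩
    suc (suc d) C 2 + suc (suc d)            ∎
    where open ≡-Reasoning

-- The shape (s , dP , dQ) of a path P ++ 0 ∷ Q through the apex, with runs P and Q of s and
-- k ∸ s vertices traversed in directions dP and dQ.
Shape : Set
Shape = ℕ × Bool × Bool

SameShape : ℕ → Shape → Shape → Set
SameShape k (s , dP , dQ) (s′ , dP′ , dQ′) =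
  s ≡ s′ × (2 ≤ s → dP ≡ dP′) × (2 ≤ k ∸ s → dQ ≡ dQ′)

-- For k = 3 + e, the shapes up to SameShape k.
Split : ℕ → Set
Split e = Bool ⊎ Bool ⊎ (Fin e × Bool × Bool)

shape : ∀ e → Split e → Shape
shape e (inj₁ dQ) = 1 , true , dQ
shape e (inj₂ (inj₁ dP)) = suc (suc e) , dP , true
shape e (inj₂ (inj₂ (j , dP , dQ))) = suc (suc (toℕ j)) , dP , dQ

shape-bounds : ∀ e σ → 1 ≤ proj₁ (shape e σ) × proj₁ (shape e σ) ≤ suc (suc e)
shape-bounds e (inj₁ _) = s≤s z≤n , s≤s z≤n
shape-bounds e (inj₂ (inj₁ _)) = s≤s z≤n , ≤-refl
shape-bounds e (inj₂ (inj₂ (j , _))) = s≤s z≤n , s≤s (s≤s (<⇒≤ (toℕ<n j)))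

shape-injective : ∀ e σ σ′ → SameShape (3 + e) (shape e σ) (shape e σ′) → σ ≡ σ′
shape-injective e (inj₁ dQ) (inj₁ dQ′) (_ , _ , dQ≡) = cong inj₁ (dQ≡ (s≤s (s≤s z≤n)))
shape-injective e (inj₂ (inj₁ dP)) (inj₂ (inj₁ dP′)) (_ , dP≡ , _) =
  cong (inj₂ ∘′ inj₁) (dP≡ (s≤s (s≤s z≤n)))
shape-injective e (inj₂ (inj₂ (j , dP , dQ))) (inj₂ (inj₂ (j′ , dP′ , dQ′))) (s≡ , dP≡ , dQ≡)
  with toℕ-injective (suc-injective (suc-injective s≡))
... | refl = cong (λ (dP , dQ) → inj₂ (inj₂ (j , dP , dQ)))
                  (cong₂ _,_ (dP≡ (s≤s (s≤s z≤n))) (dQ≡ (m+n≤o⇒m≤o∸n 2 (s≤s (toℕ<n j)))))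
shape-injective e (inj₁ _) (inj₂ (inj₁ _)) (() , _)
shape-injective e (inj₁ _) (inj₂ (inj₂ _)) (() , _)
shape-injective e (inj₂ (inj₁ _)) (inj₁ _) (() , _)
shape-injective e (inj₂ (inj₂ _)) (inj₁ _) (() , _)
shape-injective e (inj₂ (inj₁ _)) (inj₂ (inj₂ (j , _))) (s≡ , _) =
  ⊥-elim (<-irrefl (sym (suc-injective (suc-injective s≡))) (toℕ<n j))
shape-injective e (inj₂ (inj₂ (j , _))) (inj₂ (inj₁ _)) (s≡ , _) =
  ⊥-elim (<-irrefl (suc-injective (suc-injective s≡)) (toℕ<n j))

shape-surjective : ∀ e s dP dQ → 1 ≤ s → s ≤ suc (suc e) →
  ∃ λ σ → SameShape (3 + e) (shape e σ) (s , dP , dQ)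
shape-surjective e (suc zero) dP dQ _ _ = inj₁ dQ , refl , (λ { (s≤s ()) }) , (λ _ → refl)
shape-surjective e (suc (suc t)) dP dQ _ s≤ with m≤n⇒m<n∨m≡n (s≤s⁻¹ (s≤s⁻¹ s≤))
... | inj₁ t<e = inj₂ (inj₂ (fromℕ< t<e , dP , dQ)) ,
                 cong (suc ∘′ suc) (toℕ-fromℕ< t<e) , (λ _ → refl) , (λ _ → refl)
... | inj₂ refl = inj₂ (inj₁ dP) , refl , (λ _ → refl) , ⊥-elim ∘′ 2≰1
  where
  2≰1 : ¬ 2 ≤ 3 + t ∸ suc (suc t)
  2≰1 2≤ with subst (2 ≤_) (m+n∸n≡m 1 t) 2≤
  ... | s≤s ()

Fin↔Split : ∀ e → Fin (2 + (2 + e * 4)) ↔ Split e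
Fin↔Split e =
  ↔-trans +↔⊎ (2↔Bool ⊎-↔ ↔-trans +↔⊎ (2↔Bool ⊎-↔ ↔-trans *↔× (↔-refl ×-↔ Fin4↔Bool²)))
  where
  Fin4↔Bool² : Fin 4 ↔ (Bool × Bool)
  Fin4↔Bool² = ↔-trans (*↔× {2} {2}) (2↔Bool ×-↔ 2↔Bool)

ApexCode : ℕ → ℕ → Set
ApexCode e d = (Fin (suc d) × Bool) ⊎ (Placement d × Split e)

Code : ℕ → ℕ → Set
Code e d = Fin d ⊎ ApexCode e d

codeCount : ℕ → ℕ → ℕ
codeCount e d = d + (suc d * 2 + (suc (suc d) C 2) * (2 + (2 + e * 4)))

Fin↔Code : ∀ e d → Fin (codeCount e d) ↔ Code e d
Fin↔Code e d = ↔-trans +↔⊎ (↔-refl ⊎-↔ ↔-trans +↔⊎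
  (↔-trans *↔× (↔-refl ×-↔ 2↔Bool) ⊎-↔ ↔-trans *↔× (Fin↔Placement d ×-↔ Fin↔Split e)))

sides : ℕ → ℕ × ℕ → Shape → List ℕ × List ℕ
sides k (x , g) (s , dP , dQ) = run (suc x) s dP , run (suc (x + s + g)) (k ∸ s) dQ

sides-cong : ∀ k xg σ σ′ → SameShape k σ σ′ → sides k xg σ ≡ sides k xg σ′
sides-cong k (x , g) (s , dP , dQ) (.s , dP′ , dQ′) (refl , dP≡ , dQ≡) =
  cong₂ _,_ (run-cong-direction _ s dP≡) (run-cong-direction _ (k ∸ s) dQ≡)

length-sides₁ : ∀ k xg σ → length (proj₁ (sides k xg σ)) ≡ proj₁ σ
length-sides₁ k (x , g) (s , dP , dQ) = length-run _ s dP

length-sides : ∀ k xg σ → proj₁ σ ≤ k →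
  length (proj₁ (sides k xg σ)) + length (proj₂ (sides k xg σ)) ≡ k
length-sides k (x , g) (s , dP , dQ) s≤k =
  trans (cong₂ _+_ (length-run _ s dP) (length-run _ (k ∸ s) dQ)) (m+[n∸m]≡n s≤k)

sides-nonempty : ∀ k xg σ → proj₁ σ < k → ∃ λ w → w ∈ proj₂ (sides k xg σ)
sides-nonempty k (x , g) (s , dP , dQ) s<k = _ , start∈run _ (k ∸ s) dQ (m<n⇒0<n∸m s<k)

sides-ordered : ∀ k xg σ {v w} → v ∈ proj₁ (sides k xg σ) → w ∈ proj₂ (sides k xg σ) → v < w
sides-ordered k (x , g) (s , dP , dQ) {v} {w} v∈P w∈Q = begin-strict
  v                   <⟨ proj₂ (∈-run⁻ (suc x) s dP v∈P) ⟩
  s + suc x           ≡⟨ trans (+-suc s x) (cong suc (+-comm s x)) ⟩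
  suc (x + s)         ≤⟨ s≤s (m≤m+n (x + s) g) ⟩
  suc (x + s + g)     ≤⟨ proj₁ (∈-run⁻ _ (k ∸ s) dQ w∈Q) ⟩
  w                   ∎
  where open ≤-Reasoning

sides-rimPaths : ∀ k d xg σ → proj₁ σ ≤ k → proj₁ xg + proj₂ xg ≤ d →
  RimPath (suc (k + d)) (proj₁ (sides k xg σ)) × RimPath (suc (k + d)) (proj₂ (sides k xg σ))
sides-rimPaths k d (x , g) (s , dP , dQ) s≤k x+g≤d =
  rimPath-run _ x s dP P-end , rimPath-run _ (x + s + g) (k ∸ s) dQ Q-end
  where
  open ≤-Reasoning
  P-end : s + suc x ≤ suc (k + d)
  P-end = begin
    s + suc x     ≡⟨ +-suc s x ⟩
    suc (s + x)   ≤⟨ s≤s (+-mono-≤ s≤k (m+n≤o⇒m≤o x x+g≤d)) ⟩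
    suc (k + d)   ∎
  rearrange : ∀ t x s g → t + (x + s + g) ≡ t + s + (x + g)
  rearrange = solve-∀
  Q-end : k ∸ s + suc (x + s + g) ≤ suc (k + d)
  Q-end = begin
    k ∸ s + suc (x + s + g)     ≡⟨ +-suc (k ∸ s) _ ⟩
    suc (k ∸ s + (x + s + g))   ≡⟨ cong suc (rearrange (k ∸ s) x s g) ⟩
    suc (k ∸ s + s + (x + g))   ≡⟨ cong (λ t → suc (t + (x + g))) (m∸n+n≡m s≤k) ⟩
    suc (k + (x + g))           ≤⟨ s≤s (+-monoʳ-≤ k x+g≤d) ⟩
    suc (k + d)                 ∎

sides-injective : ∀ k xg xg′ σ σ′ → 1 ≤ proj₁ σ → proj₁ σ < k →
  sides k xg σ ≡ sides k xg′ σ′ → xg ≡ xg′ × SameShape k σ σ′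
sides-injective k (x , g) (x′ , g′) (s , dP , dQ) (s′ , dP′ , dQ′) 1≤s s<k eq
  with run-injective (suc x) (suc x′) s s′ dP dP′ (cong proj₁ eq)
... | refl , x≡ , dP≡ with run-injective _ _ (k ∸ s) (k ∸ s) dQ dQ′ (cong proj₂ eq)
... | _ , start≡ , dQ≡ with suc-injective (x≡ 1≤s)
... | refl = cong (x ,_) (+-cancelˡ-≡ (x + s) g g′ (suc-injective (start≡ (m<n⇒0<n∸m s<k)))) ,
             refl , dP≡ , dQ≡

module _ (e d : ℕ) where

  private
    k = 3 + e
    n = suc (k + d)

  apexSides : ApexCode e d → List ℕ × List ℕ
  apexSides (inj₁ (a , dir)) = [] , run (suc (toℕ a)) k dir
  apexSides (inj₂ (p , σ)) = sides k (placement d p) (shape e σ)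

  codePath : Code e d → List ℕ
  codePath (inj₁ a) = up (suc (toℕ a)) (suc k)
  codePath (inj₂ c) = viaApex (apexSides c)

  shape≤k : ∀ σ → proj₁ (shape e σ) ≤ k
  shape≤k σ = m≤n⇒m≤1+n (proj₂ (shape-bounds e σ))

  apexSides-rimPaths : ∀ c → RimPath n (proj₁ (apexSides c)) ×
                             RimPath n (proj₂ (apexSides c))
  apexSides-rimPaths (inj₁ (a , dir)) = rimPath-[] , rimPath-run _ (toℕ a) k dir end
    where
    end : k + suc (toℕ a) ≤ n
    end = ≤-trans (≤-reflexive (+-suc k (toℕ a))) (s≤s (+-monoʳ-≤ k (s≤s⁻¹ (toℕ<n a))))
  apexSides-rimPaths (inj₂ (p , σ)) = sides-rimPaths k d _ (shape e σ) (shape≤k σ) (placement-bound d p)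

  apexSides-ordered : ∀ c {v w} → v ∈ proj₁ (apexSides c) → w ∈ proj₂ (apexSides c) → v < w
  apexSides-ordered (inj₁ _) ()
  apexSides-ordered (inj₂ (p , σ)) = sides-ordered k (placement d p) (shape e σ)

  length-apexSides : ∀ c → length (proj₁ (apexSides c)) + length (proj₂ (apexSides c)) ≡ k
  length-apexSides (inj₁ (a , dir)) = length-run _ k dir
  length-apexSides (inj₂ (p , σ)) = length-sides k (placement d p) (shape e σ) (shape≤k σ)

  fanPath-codePath : ∀ c → FanPath n (codePath c)
  fanPath-codePath (inj₁ a) =
    rimPath⇒fanPath (rimPath-run _ (toℕ a) (suc k) true (s≤s (+-monoʳ-≤ k (toℕ<n a))))
  fanPath-codePath (inj₂ c) =
    fanPath-viaApex (proj₁ (apexSides-rimPaths c)) (proj₂ (apexSides-rimPaths c))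
                    (λ v∈P v∈Q → <-irrefl refl (apexSides-ordered c v∈P v∈Q))

  length-codePath : ∀ c → length (codePath c) ≡ suc k
  length-codePath (inj₁ a) = length-up _ _
  length-codePath (inj₂ c) = begin
    length (P ++ 0 ∷ Q)          ≡⟨ length-++ P ⟩
    length P + suc (length Q)    ≡⟨ +-suc (length P) (length Q) ⟩
    suc (length P + length Q)    ≡⟨ cong suc (length-apexSides c) ⟩
    suc k                    ∎
    where
    open ≡-Reasoning
    P = proj₁ (apexSides c)
    Q = proj₂ (apexSides c)

  apexSides-avoid-apex : ∀ c → 0 ∉ proj₁ (apexSides c) × 0 ∉ proj₂ (apexSides c)
  apexSides-avoid-apex c =
    (λ 0∈ → RimPath.onRim (proj₁ (apexSides-rimPaths c)) 0∈ refl) ,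
    (λ 0∈ → RimPath.onRim (proj₂ (apexSides-rimPaths c)) 0∈ refl)

  apexSides-nonempty : ∀ c → ∃ λ w → w ∈ proj₂ (apexSides c)
  apexSides-nonempty (inj₁ (a , dir)) = _ , start∈run _ k dir (s≤s z≤n)
  apexSides-nonempty (inj₂ (p , σ)) =
    sides-nonempty k (placement d p) (shape e σ) (s≤s (proj₂ (shape-bounds e σ)))

  through-apex-side≢[] : ∀ p σ → proj₁ (apexSides (inj₂ (p , σ))) ≢ []
  through-apex-side≢[] p σ eq = <⇒≢ (proj₁ (shape-bounds e σ))
    (trans (cong length (sym eq)) (length-sides₁ k (placement d p) (shape e σ)))

  apexSides-injective : ∀ c c′ → apexSides c ≡ apexSides c′ → c ≡ c′
  apexSides-injective (inj₁ (a , dir)) (inj₁ (a′ , dir′)) eq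
    with run-injective (suc (toℕ a)) (suc (toℕ a′)) k k dir dir′ (cong proj₂ eq)
  ... | _ , a≡ , dir≡ =
    cong inj₁ (cong₂ _,_ (toℕ-injective (suc-injective (a≡ (s≤s z≤n)))) (dir≡ (s≤s (s≤s z≤n))))
  apexSides-injective (inj₁ _) (inj₂ (p , σ)) eq = ⊥-elim (through-apex-side≢[] p σ (sym (cong proj₁ eq)))
  apexSides-injective (inj₂ (p , σ)) (inj₁ _) eq = ⊥-elim (through-apex-side≢[] p σ (cong proj₁ eq))
  apexSides-injective (inj₂ (p , σ)) (inj₂ (p′ , σ′)) eq
    with sides-injective k _ _ (shape e σ) (shape e σ′)
           (proj₁ (shape-bounds e σ)) (s≤s (proj₂ (shape-bounds e σ))) eq
  ... | xg≡ , same =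
    cong inj₂ (cong₂ _,_ (placement-injective d p p′ xg≡) (shape-injective e σ σ′ same))

  -- Both sides are nonempty and the first lies below the second, which reversal would swap.
  apexSides-not-reversed : ∀ c c′ → apexSides c ≡
    (reverse (proj₂ (apexSides c′)) , reverse (proj₁ (apexSides c′))) → ⊥
  apexSides-not-reversed c c′ eq with apexSides-nonempty c | apexSides-nonempty c′
  ... | w , w∈Q | v , v∈Q′ = <-asym (apexSides-ordered c v∈P w∈Q) (apexSides-ordered c′ w∈P′ v∈Q′)
    where
    v∈P : v ∈ proj₁ (apexSides c)
    v∈P = subst (v ∈_) (sym (cong proj₁ eq)) (Any.reverse⁺ v∈Q′)
    w∈P′ : w ∈ proj₁ (apexSides c′)
    w∈P′ = Any.reverse⁻ (subst (w ∈_) (cong proj₂ eq) w∈Q)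

  codePath-injective : ∀ c c′ → codePath c ≡ codePath c′ → c ≡ c′
  codePath-injective (inj₁ a) (inj₁ a′) eq = cong inj₁ (toℕ-injective (suc-injective (∷-injectiveˡ eq)))
  codePath-injective (inj₁ a) (inj₂ c′) eq =
    ⊥-elim (0∉run (toℕ a) _ true (subst (0 ∈_) (sym eq) (0∈viaApex (proj₁ (apexSides c′)) _)))
  codePath-injective (inj₂ c) (inj₁ a′) eq =
    ⊥-elim (0∉run (toℕ a′) _ true (subst (0 ∈_) eq (0∈viaApex (proj₁ (apexSides c)) _)))
  codePath-injective (inj₂ c) (inj₂ c′) eq = cong inj₂ (apexSides-injective c c′
    (viaApex-injective (proj₁ (apexSides c)) _ (proj₁ (apexSides c′)) _
      (proj₁ (apexSides-avoid-apex c)) (proj₁ (apexSides-avoid-apex c′)) eq))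

  codePath-not-reversed : ∀ c c′ → codePath c ≢ reverse (codePath c′)
  codePath-not-reversed (inj₁ a) (inj₁ a′) eq
    with run-injective (suc (toℕ a)) (suc (toℕ a′)) (suc k) (suc k) true false
         (trans eq (reverse-up (suc (toℕ a′)) (suc k)))
  ... | _ , _ , dir≡ with dir≡ (s≤s (s≤s z≤n))
  ... | ()
  codePath-not-reversed (inj₁ a) (inj₂ c′) eq =
    0∉run (toℕ a) (suc k) true
      (subst (0 ∈_) (sym eq) (Any.reverse⁺ (0∈viaApex (proj₁ (apexSides c′)) _)))
  codePath-not-reversed (inj₂ c) (inj₁ a′) eq =
    0∉run (toℕ a′) (suc k) true (Any.reverse⁻ (subst (0 ∈_) eq (0∈viaApex (proj₁ (apexSides c)) _)))
  codePath-not-reversed (inj₂ c) (inj₂ c′) eq = apexSides-not-reversed c c′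
    (viaApex-injective P Q (reverse Q′) (reverse P′) (proj₁ (apexSides-avoid-apex c))
      (proj₂ (apexSides-avoid-apex c′) ∘′ Any.reverse⁻) (trans eq (reverse-viaApex P′ Q′)))
    where
    P = proj₁ (apexSides c)
    Q = proj₂ (apexSides c)
    P′ = proj₁ (apexSides c′)
    Q′ = proj₂ (apexSides c′)

  CodeFor : List ℕ → Set
  CodeFor L = ∃ λ c → codePath c ≡ L ⊎ codePath c ≡ reverse L

  ApexCodeFor : List ℕ → List ℕ → Set
  ApexCodeFor P Q = ∃ λ c → apexSides c ≡ (P , Q) ⊎ apexSides c ≡ (reverse Q , reverse P)

  rim-run⇒code : ∀ b dir → k + suc b < n → CodeFor (run (suc b) (suc k) dir)
  rim-run⇒code b dir end = inj₁ (fromℕ< b<d) , oriented dir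
    where
    b<d : b < d
    b<d = +-cancelˡ-≤ k (suc b) d (s≤s⁻¹ end)
    start≡ : codePath (inj₁ (fromℕ< b<d)) ≡ up (suc b) (suc k)
    start≡ = cong (λ a → up (suc a) (suc k)) (toℕ-fromℕ< b<d)
    oriented : ∀ dir → codePath (inj₁ (fromℕ< b<d)) ≡ run (suc b) (suc k) dir ⊎
                       codePath (inj₁ (fromℕ< b<d)) ≡ reverse (run (suc b) (suc k) dir)
    oriented true = inj₁ start≡
    oriented false = inj₂ (trans start≡ (sym (reverse-run (suc b) (suc k) false)))

  rimPath⇒code : ∀ L → RimPath n L → length L ≡ suc k → CodeFor L
  rimPath⇒code (x ∷ r) rimL len with rimPath⇒run rimL
  ... | b , s , dir , L≡ , end with suc-injective (length-≡run (suc b) (suc s) dir L≡ len)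
  ... | refl = subst CodeFor (sym L≡) (rim-run⇒code b dir end)

  rim-run⇒apexCode : ∀ b t dir → t + suc b < n → suc t ≡ k →
    ∃ λ c → apexSides c ≡ ([] , run (suc b) (suc t) dir)
  rim-run⇒apexCode b t dir end refl = inj₁ (fromℕ< b≤d , dir) ,
    cong (λ a → [] , run (suc a) k dir) (toℕ-fromℕ< b≤d)
    where
    b≤d : b < suc d
    b≤d = s≤s (+-cancelˡ-≤ t b d (s≤s⁻¹ (subst (_≤ suc (t + d)) (+-suc t b) (s≤s⁻¹ end))))

  ordered-runs⇒apexCode : ∀ a s dP b t dQ →
    suc s + suc a ≤ suc b → t + suc b < n → suc s + suc t ≡ k →
    ∃ λ c → apexSides c ≡ (run (suc a) (suc s) dP , run (suc b) (suc t) dQ)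
  ordered-runs⇒apexCode a s dP b t dQ P-before-Q end lengths = inj₂ (p , σ) , (begin
    sides k (placement d p) (shape e σ)   ≡⟨ cong (λ xg → sides k xg (shape e σ)) p≡ ⟩
    sides k (a , g) (shape e σ)           ≡⟨ sides-cong k (a , g) _ _ same ⟩
    (run (suc a) (suc s) dP , run (suc (a + suc s + g)) (k ∸ suc s) dQ)
      ≡⟨ cong₂ (λ u m → run (suc a) (suc s) dP , run (suc u) m dQ) Q-start Q-length ⟩
    (run (suc a) (suc s) dP , run (suc b) (suc t) dQ)   ∎)
    where
    open ≡-Reasoning
    P-end≤b : a + suc s ≤ b
    P-end≤b = subst (_≤ b) (trans (+-comm s (suc a)) (sym (+-suc a s))) (s≤s⁻¹ P-before-Q)
    g = b ∸ (a + suc s)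
    Q-start : a + suc s + g ≡ b
    Q-start = m+[n∸m]≡n P-end≤b
    Q-length : k ∸ suc s ≡ suc t
    Q-length = trans (cong (_∸ suc s) (sym lengths)) (m+n∸m≡n (suc s) (suc t))
    rearrange : ∀ a s t g → suc s + suc t + (a + g) ≡ t + suc (a + suc s + g)
    rearrange = solve-∀
    k+a+g≡ : k + (a + g) ≡ t + suc b
    k+a+g≡ = begin
      k + (a + g)                ≡⟨ cong (_+ (a + g)) lengths ⟨
      suc s + suc t + (a + g)    ≡⟨ rearrange a s t g ⟩
      t + suc (a + suc s + g)    ≡⟨ cong (λ u → t + suc u) Q-start ⟩
      t + suc b                  ∎
    a+g≤d : a + g ≤ d
    a+g≤d = +-cancelˡ-≤ k _ _ (subst (_≤ k + d) (sym k+a+g≡) (s≤s⁻¹ end))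
    s≤2+e : suc s ≤ suc (suc e)
    s≤2+e = subst (suc s ≤_) (trans (sym (+-suc s t)) (suc-injective lengths)) (s≤s (m≤m+n s t))
    p = proj₁ (placement-surjective d a g a+g≤d)
    p≡ = proj₂ (placement-surjective d a g a+g≤d)
    σ = proj₁ (shape-surjective e (suc s) dP dQ (s≤s z≤n) s≤2+e)
    same = proj₂ (shape-surjective e (suc s) dP dQ (s≤s z≤n) s≤2+e)

  single-side⇒apexCode : ∀ Q → RimPath n Q → length Q ≡ k → ∃ λ c → apexSides c ≡ ([] , Q)
  single-side⇒apexCode (q ∷ Q) rimQ len with rimPath⇒run rimQ
  ... | b , t , dir , Q≡ , end with rim-run⇒apexCode b t dir end (length-≡run (suc b) (suc t) dir Q≡ len)
  ...   | c , c≡ = c , trans c≡ (cong ([] ,_) (sym Q≡))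

  two-runs⇒apexCode : ∀ a s dP b t dQ → s + suc a < n → t + suc b < n →
    Disjoint (run (suc a) (suc s) dP) (run (suc b) (suc t) dQ) → suc s + suc t ≡ k →
    ApexCodeFor (run (suc a) (suc s) dP) (run (suc b) (suc t) dQ)
  two-runs⇒apexCode a s dP b t dQ P-end Q-end disjoint lengths
    with disjoint-runs-separated (suc a) (suc s) (suc b) (suc t) dP dQ (s≤s z≤n) (s≤s z≤n) disjoint
  ... | inj₁ P-before-Q = map₂ inj₁ (ordered-runs⇒apexCode a s dP b t dQ P-before-Q Q-end lengths)
  ... | inj₂ Q-before-P with ordered-runs⇒apexCode b t (not dQ) a s (not dP) Q-before-P P-end
                               (trans (+-comm (suc t) (suc s)) lengths)
  ...   | c , c≡ = c , inj₂ (trans c≡ (sym (cong₂ _,_ (reverse-run _ (suc t) dQ) (reverse-run _ (suc s) dP))))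

  sides⇒apexCode : ∀ P Q → RimPath n P → RimPath n Q → Disjoint P Q →
    length P + length Q ≡ k → ApexCodeFor P Q
  sides⇒apexCode [] Q _ rimQ _ len = map₂ inj₁ (single-side⇒apexCode Q rimQ len)
  sides⇒apexCode (p ∷ P) [] rimP _ _ len = map₂ inj₂ (single-side⇒apexCode (reverse (p ∷ P))
    (rimPath-reverse rimP) (trans (length-reverse (p ∷ P)) (trans (sym (+-identityʳ _)) len)))
  sides⇒apexCode (p ∷ P) (q ∷ Q) rimP rimQ disjoint len with rimPath⇒run rimP | rimPath⇒run rimQ
  ... | a , s , dP , P≡ , P-end | b , t , dQ , Q≡ , Q-end =
    subst₂ ApexCodeFor (sym P≡) (sym Q≡) (two-runs⇒apexCode a s dP b t dQ P-end Q-end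
      (subst₂ Disjoint P≡ Q≡ disjoint)
      (trans (sym (cong₂ _+_ (length-run _ (suc s) dP) (length-run _ (suc t) dQ)))
             (subst₂ (λ P Q → length P + length Q ≡ k) P≡ Q≡ len)))

  viaApex⇒code : ∀ P Q → FanPath n (viaApex (P , Q)) → length (viaApex (P , Q)) ≡ suc k →
    CodeFor (viaApex (P , Q))
  viaApex⇒code P Q fanL len with fanPath-viaApex⁻ P Q fanL
  ... | rimP , rimQ , disjoint with sides⇒apexCode P Q rimP rimQ disjoint lengths
    where
    lengths : length P + length Q ≡ k
    lengths = suc-injective (trans (sym (+-suc (length P) (length Q))) (trans (sym (length-++ P)) len))
  ... | c , inj₁ c≡ = inj₂ c , inj₁ (cong viaApex c≡)
  ... | c , inj₂ c≡ = inj₂ c , inj₂ (trans (cong viaApex c≡) (sym (reverse-viaApex P Q)))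

  fanPath⇒code : ∀ L → FanPath n L → length L ≡ suc k → CodeFor L
  fanPath⇒code L fanL len with 0 ∈? L
  ... | no 0∉L = rimPath⇒code L (fanPath⇒rimPath (λ { v∈L refl → 0∉L v∈L }) fanL) len
  ... | yes 0∈L with ∈-∃++ 0∈L
  ...   | P , Q , refl = viaApex⇒code P Q fanL len

  codeSubgraph : Code e d → Subset n × EdgeSet n
  codeSubgraph c = vertexSet n (codePath c) , edgeSet n (codePath c)

  codeSubgraph-pathSubgraph : ∀ c → IsPathSubgraph (suc k) (proj₁ (codeSubgraph c)) (proj₂ (codeSubgraph c))
  codeSubgraph-pathSubgraph c =
    subst (λ m → IsPathSubgraph m (proj₁ (codeSubgraph c)) (proj₂ (codeSubgraph c))) (length-codePath c)
      (fanPath⇒pathSubgraph (codePath c) (fanPath-codePath c))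

  codeSubgraph-injective : Injective _≡_ _≡_ codeSubgraph
  codeSubgraph-injective {c} {c′} eq
    with same-edges⇒≡⊎reverse (codePath c) (codePath c′) two≤
           (FanPath.distinct fan) (FanPath.distinct fan′)
           (edgeSet⇒⊆ₑ _ _ _ (FanPath.bounded fan) (cong proj₂ eq))
           (edgeSet⇒⊆ₑ _ _ _ (FanPath.bounded fan′) (sym (cong proj₂ eq)))
    where
    fan = fanPath-codePath c
    fan′ = fanPath-codePath c′
    two≤ : 2 ≤ length (codePath c′)
    two≤ = subst (2 ≤_) (sym (length-codePath c′)) (s≤s (s≤s z≤n))
  ... | inj₁ same = codePath-injective c c′ (sym same)
  ... | inj₂ reversed = ⊥-elim (codePath-not-reversed c′ c reversed)

  codeSubgraph-onto : ∀ VE → IsPathSubgraph (suc k) (proj₁ VE) (proj₂ VE) →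
    ∃ λ c → codeSubgraph c ≡ VE
  codeSubgraph-onto (V , E) pathVE with pathSubgraph⇒fanPath V E pathVE
  ... | L , fanL , len , V≡ , E≡ with fanPath⇒code L fanL len
  ... | c , inj₁ c≡ = c , cong₂ _,_ (trans (cong (vertexSet n) c≡) V≡) (trans (cong (edgeSet n) c≡) E≡)
  ... | c , inj₂ c≡ = c , cong₂ _,_ (trans (cong (vertexSet n) c≡) (trans (vertexSet-reverse _ L) V≡))
                                   (trans (cong (edgeSet n) c≡) (trans (edgeSet-reverse _ L) E≡))

  Fin↔SubgraphsIsoPath : Fin (codeCount e d) ↔ SubgraphsIsoPath n (suc k)
  Fin↔SubgraphsIsoPath = ↔-trans (Fin↔Code e d) (↔-trans
    (finite-injection-onto⇒↔ (Fin↔Code e d) (Product.≡-dec subset-≟ edgeSet-≟)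
      codeSubgraph codeSubgraph-injective codeSubgraph-pathSubgraph codeSubgraph-onto)
    Σ-assoc)
    where
    subset-≟ : DecidableEquality (Subset n)
    subset-≟ = Vec.≡-dec Bool._≟_
    edgeSet-≟ : DecidableEquality (EdgeSet n)
    edgeSet-≟ = Vec.≡-dec (Vec.≡-dec Bool._≟_)

  pathCount≡codeCount : pathCount n k ≡ codeCount e d
  pathCount≡codeCount = cong (_∸ 1) (begin
    4 * suc e * ((n + 1 ∸ k) C 2) + 3 * (n ∸ k)
      ≡⟨ cong₂ (λ a b → 4 * suc e * (a C 2) + 3 * b) n+1∸k n∸k ⟩
    4 * suc e * (suc (suc d) C 2) + 3 * suc d
      ≡⟨ rearrange e d (suc (suc d) C 2) ⟩
    suc (codeCount e d) ∎)
    where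
    open ≡-Reasoning
    shift : ∀ e d → 4 + (e + d) + 1 ≡ 3 + e + (2 + d)
    shift = solve-∀
    n+1∸k : n + 1 ∸ k ≡ suc (suc d)
    n+1∸k = trans (cong (_∸ k) (shift e d)) (m+n∸m≡n k (suc (suc d)))
    n∸k : n ∸ k ≡ suc d
    n∸k = trans (cong (_∸ k) (sym (+-suc k d))) (m+n∸m≡n k (suc d))
    rearrange : ∀ e d c → 4 * suc e * c + 3 * suc d ≡ suc (d + (suc d * 2 + c * (2 + (2 + e * 4))))
    rearrange = solve-∀

mainTheorem14 : (n k : ℕ) → 3 ≤ k → k < n →
    Fin (pathCount n k) ↔ SubgraphsIsoPath n (suc k)
mainTheorem14 n (suc (suc (suc e))) (s≤s (s≤s (s≤s z≤n))) k<n with m≤n⇒∃[o]m+o≡n k<n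
... | d , refl = subst (λ N → Fin N ↔ SubgraphsIsoPath (suc (3 + e + d)) (4 + e))
                       (sym (pathCount≡codeCount e d)) (Fin↔SubgraphsIsoPath e d)
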